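{- Let $G$ be a graph with $g$ vertices and $Q=\gamma(G)$, let $n\ge3$, $r=\lceil n/2\rceil$ and $P=2^r+2^{n-r+1}-3$. Suppose $D$ is a non-coverable distribution of $PQ$ pebbles on $G\square C_n$, and let $\tilde D$ be its associated $g$-colored distribution on $\tilde C_n$. Then there exists a sequential labeling $V_1,\dots,V_n$ of the vertices of $\tilde C_n$ such that: (1) $V_1,\dots,V_r$ is primary and saturated; (2) there exists $i\le r+1$ such that $V_i,\dots,V_{i+r-1}$ (indices mod $n$) is unsaturated; and (3) there are no support vertices $V_s$ with $1<s<i$.
   Context: All graphs are finite and connected; $C_n$ is the cycle on $n$ vertices. A pebbling step removes two pebbles from a vertex and places one pebble on an adjacent vertex; a distribution is coverable if some sequence of pebbling steps leaves at least one pebble on every vertex; $\gamma(G)$ is the minimum $N$ such that every distribution of $N$ pebbles on $G$ is coverable. $G\square H$ is the Cartesian product of graphs. Writing $V(G)=\{w_1,\dots,w_g\}$ and $V(C_n)=\{v_1,\dots,v_n\}$, the associated $g$-colored distribution $\tilde D$ on $\tilde C_n$ (a copy of $C_n$ with vertices $V_j$ corresponding to $v_j$) is obtained by coloring each pebble that $D$ places on $(w_i,v_j)$ with color $c_i$ and placing it on $V_j$. A support vertex is a vertex carrying at least one pebble of $\tilde D$. A set $V_k,\dots,V_{k+r-1}$ of $r$ consecutive vertices is called primary if $V_k$ is a support vertex, and saturated if it carries at least $Q(2^r-1)$ pebbles (unsaturated otherwise). -}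

module Defs where

open import Data.Nat using (ℕ; zero; suc; _+_; _*_; _∸_; _^_; _≤_; _<_)
open import Data.Nat.DivMod using (_mod_)
open import Data.Fin using (Fin; toℕ)
open import Data.Bool using (Bool; true; false)
open import Data.Product using (_×_; _,_; ∃; ∃-syntax)
open import Data.Sum using (_⊎_)
open import Data.Empty using (⊥)
open import Relation.Nullary using (¬_)
open import Relation.Binary.PropositionalEquality using (_≡_; _≢_)
open import Relation.Binary.Construct.Closure.ReflexiveTransitive using (Star)

record Graph : Set₁ where
  field
    size      : ℕ
    Adj       : Fin size → Fin size → Set
    adj-sym   : ∀ {u v} → Adj u v → Adj v u
    adj-irrefl : ∀ {u} → ¬ Adj u u
    connected : ∀ u v → Star Adj u v

Σᶠ : (n : ℕ) → (Fin n → ℕ) → ℕ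
Σᶠ zero    f = 0
Σᶠ (suc n) f = f Fin.zero + Σᶠ n (λ i → f (Fin.suc i))
  where import Data.Fin as Fin

PebblingStep : {V : Set} → (V → V → Set) → (V → ℕ) → (V → ℕ) → Set
PebblingStep {V} Adj D D′ =
  ∃[ u ] ∃[ v ] (Adj u v × 2 ≤ D u × D′ u + 2 ≡ D u × D′ v ≡ suc (D v)
                 × (∀ w → w ≢ u → w ≢ v → D′ w ≡ D w))

Coverable : {V : Set} → (V → V → Set) → (V → ℕ) → Set
Coverable {V} Adj D = ∃[ D′ ] (Star (PebblingStep Adj) D D′ × (∀ v → 1 ≤ D′ v))

AllCoverable : Graph → ℕ → Set
AllCoverable G N = ∀ (D : Fin (Graph.size G) → ℕ) →
  Σᶠ (Graph.size G) D ≡ N → Coverable (Graph.Adj G) D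

IsCoverPebblingNumber : Graph → ℕ → Set
IsCoverPebblingNumber G Q = AllCoverable G Q × (∀ N → AllCoverable G N → Q ≤ N)

CycAdj : (n : ℕ) → Fin n → Fin n → Set
CycAdj n i j = toℕ j ≡ suc (toℕ i) ⊎ toℕ i ≡ suc (toℕ j)
             ⊎ (toℕ i ≡ 0 × suc (toℕ j) ≡ n) ⊎ (toℕ j ≡ 0 × suc (toℕ i) ≡ n)

ProdAdj : (G : Graph) (n : ℕ) → (Fin (Graph.size G) × Fin n) → (Fin (Graph.size G) × Fin n) → Set
ProdAdj G n (w , v) (w′ , v′) = (w ≡ w′ × CycAdj n v v′) ⊎ (Graph.Adj G w w′ × v ≡ v′)

totalProd : (g n : ℕ) → (Fin g × Fin n → ℕ) → ℕ
totalProd g n D = Σᶠ g (λ i → Σᶠ n (λ j → D (i , j)))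

-- Number of pebbles (of all colours) that the associated g-coloured
-- distribution D̃ places on V_j of C̃_n: all pebbles D places on (w_i , v_j).
tildeD : (g n : ℕ) → (Fin g × Fin n → ℕ) → Fin n → ℕ
tildeD g n D j = Σᶠ g (λ i → D (i , j))

-- Sequential labeling of C_n (1-based index s): start at vertex k and go
-- forward (true) or backward (false) around the cycle; indices taken mod n.
seqLab : {n : ℕ} → Fin n → Bool → ℕ → Fin n
seqLab {suc m} k true  s = (toℕ k + (s ∸ 1)) mod (suc m)
seqLab {suc m} k false s = (toℕ k + m * (s ∸ 1)) mod (suc m)

window : (ℕ → ℕ) → ℕ → ℕ → ℕ
window f i zero    = 0
window f i (suc r) = f i + window f (suc i) r

Support : ℕ → Set
Support c = 1 ≤ c

Saturated : (f : ℕ → ℕ) (Q r i : ℕ) → Set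
Saturated f Q r i = Q * (2 ^ r ∸ 1) ≤ window f i r

Primary : (f : ℕ → ℕ) (i : ℕ) → Set
Primary f i = Support (f i)

-- An arc of l
-- consecutive vertices carrying Q(2^l − 1) pebbles can be covered from its own pebbles:
-- walking along it, each copy of G keeps what it needs and sends the surplus on in pairs,
-- or, when short, borrows twice its deficit from the rest of the arc. So if D is not
-- coverable, no two complementary arcs are both saturated, which yields an unsaturated
-- window of length ⌈n/2⌉, while the total P·Q forces a saturated one. Walking around the
-- cycle from the saturated window to the unsaturated one gives a saturated window at V₁
-- followed by an unsaturated one at V₂; then V₁ is a support vertex, and i = 2 works.

module Submission where

open import Defs
open import Data.Nat using (ℕ; zero; suc; _+_; _*_; _∸_; _^_; _≤_; _<_; z≤n; s≤s; _≤?_; _<?_; NonZero; ⌊_/2⌋; ⌈_/2⌉)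
open import Data.Nat.Properties
open import Data.Nat.DivMod
  using (_mod_; _%_; _/_; m%n<n; m≡m%n+[m/n]*n; m<n⇒m%n≡m; [m+n]%n≡m%n; [m+kn]%n≡m%n; n%n≡0; %-distribˡ-+; m%n%n≡m%n)
open import Data.Nat.Tactic.RingSolver using (solve-∀)
open import Algebra.Properties.CommutativeSemigroup +-commutativeSemigroup
  using (interchange; xy∙z≈xz∙y; x∙yz≈xz∙y; xy∙z≈x∙zy)
open import Algebra.Properties.CommutativeSemigroup *-commutativeSemigroup
  using () renaming (x∙yz≈y∙xz to *-left-comm)
open import Data.Fin as Fin using (Fin; toℕ)
open import Data.Fin.Properties using (toℕ-fromℕ<; toℕ-injective; toℕ<n; any?)
open import Data.Bool using (true; false; if_then_else_)
open import Data.Product using (_×_; _,_; ∃; ∃-syntax; proj₂)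
open import Data.Sum using (_⊎_; inj₁; inj₂)
open import Data.Empty using (⊥; ⊥-elim)
open import Function using (_∘_)
open import Relation.Nullary using (¬_; yes; no; does)
open import Relation.Binary.PropositionalEquality
open import Relation.Binary.Construct.Closure.ReflexiveTransitive using (Star; ε; _◅_; _◅◅_; gmap)

-- Finite sums and windows

Σᶠ-cong : ∀ k {a b : Fin k → ℕ} → (∀ i → a i ≡ b i) → Σᶠ k a ≡ Σᶠ k b
Σᶠ-cong zero    eq = refl
Σᶠ-cong (suc k) eq = cong₂ _+_ (eq Fin.zero) (Σᶠ-cong k (eq ∘ Fin.suc))

Σᶠ-mono : ∀ k {a b : Fin k → ℕ} → (∀ i → a i ≤ b i) → Σᶠ k a ≤ Σᶠ k b
Σᶠ-mono zero    le = z≤n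
Σᶠ-mono (suc k) le = +-mono-≤ (le Fin.zero) (Σᶠ-mono k (le ∘ Fin.suc))

Σᶠ-+ : ∀ k (a b : Fin k → ℕ) → Σᶠ k (λ i → a i + b i) ≡ Σᶠ k a + Σᶠ k b
Σᶠ-+ zero    a b = refl
Σᶠ-+ (suc k) a b = trans (cong (a Fin.zero + b Fin.zero +_) (Σᶠ-+ k (a ∘ Fin.suc) (b ∘ Fin.suc)))
                         (interchange (a Fin.zero) (b Fin.zero) _ _)

Σᶠ-const : ∀ k c → Σᶠ k (λ _ → c) ≡ k * c
Σᶠ-const zero    c = refl
Σᶠ-const (suc k) c = cong (c +_) (Σᶠ-const k c)

Σᶠ-zero : ∀ k → Σᶠ k (λ _ → 0) ≡ 0
Σᶠ-zero k = trans (Σᶠ-const k 0) (*-zeroʳ k)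

Σᶠ-*ˡ : ∀ k c (a : Fin k → ℕ) → Σᶠ k (λ i → c * a i) ≡ c * Σᶠ k a
Σᶠ-*ˡ zero    c a = sym (*-zeroʳ c)
Σᶠ-*ˡ (suc k) c a = trans (cong (c * a Fin.zero +_) (Σᶠ-*ˡ k c (a ∘ Fin.suc)))
                          (sym (*-distribˡ-+ c (a Fin.zero) _))

Σᶠ-comm : ∀ k l (f : Fin k → Fin l → ℕ) →
          Σᶠ k (λ i → Σᶠ l (f i)) ≡ Σᶠ l (λ j → Σᶠ k (λ i → f i j))
Σᶠ-comm zero    l f = sym (Σᶠ-zero l)
Σᶠ-comm (suc k) l f = trans (cong (Σᶠ l (f Fin.zero) +_) (Σᶠ-comm k l (f ∘ Fin.suc)))
                            (sym (Σᶠ-+ l (f Fin.zero) _))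

size≤Σᶠ : ∀ k {a : Fin k → ℕ} → (∀ i → 1 ≤ a i) → k ≤ Σᶠ k a
size≤Σᶠ zero    pos = z≤n
size≤Σᶠ (suc k) pos = +-mono-≤ (pos Fin.zero) (size≤Σᶠ k (pos ∘ Fin.suc))

indicator : ∀ {k} → Fin k → Fin k → ℕ → ℕ
indicator u v c = if does (u Fin.≟ v) then c else 0

indicator-diag : ∀ {k} (u : Fin k) c → indicator u u c ≡ c
indicator-diag u c with u Fin.≟ u
... | yes _   = refl
... | no u≢u = ⊥-elim (u≢u refl)

indicator-zero : ∀ {k} (u v : Fin k) → indicator u v 0 ≡ 0
indicator-zero u v with does (u Fin.≟ v)
... | true  = refl
... | false = refl

indicator-+ : ∀ {k} (u v : Fin k) a b → indicator u v (a + b) ≡ indicator u v a + indicator u v b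
indicator-+ u v a b with does (u Fin.≟ v)
... | true  = refl
... | false = refl

Σᶠ-indicator : ∀ k (a : Fin k → ℕ) (v : Fin k) → Σᶠ k (λ u → indicator u v (a u)) ≡ a v
Σᶠ-indicator (suc k) a Fin.zero    = trans (cong (a Fin.zero +_) (Σᶠ-zero k)) (+-identityʳ _)
Σᶠ-indicator (suc k) a (Fin.suc v) = Σᶠ-indicator k (a ∘ Fin.suc) v

Σᶠ-select : ∀ k (x : Fin k → ℕ) m → m ≤ Σᶠ k x → ∃[ z ] ((∀ i → z i ≤ x i) × Σᶠ k z ≡ m)
Σᶠ-select zero    x .zero z≤n = (λ ()) , (λ ()) , refl
Σᶠ-select (suc k) x m m≤Σx with m ≤? x Fin.zero
... | yes m≤x₀ = z , z≤x , trans (cong (m +_) (Σᶠ-zero k)) (+-identityʳ m)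
  where
  z : Fin (suc k) → ℕ
  z Fin.zero    = m
  z (Fin.suc i) = 0
  z≤x : ∀ i → z i ≤ x i
  z≤x Fin.zero    = m≤x₀
  z≤x (Fin.suc i) = z≤n
... | no m≰x₀ with Σᶠ-select k (x ∘ Fin.suc) (m ∸ x Fin.zero)
                     (+-cancelˡ-≤ (x Fin.zero) _ _ (subst (_≤ Σᶠ (suc k) x) (sym x₀+[m∸x₀]≡m) m≤Σx))
  where x₀+[m∸x₀]≡m = m+[n∸m]≡n (<⇒≤ (≰⇒> m≰x₀))
... | z′ , z′≤x , Σz′ = z , z≤x , trans (cong (x Fin.zero +_) Σz′) (m+[n∸m]≡n (<⇒≤ (≰⇒> m≰x₀)))
  where
  z : Fin (suc k) → ℕ
  z Fin.zero    = x Fin.zero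
  z (Fin.suc i) = z′ i
  z≤x : ∀ i → z i ≤ x i
  z≤x Fin.zero    = ≤-refl
  z≤x (Fin.suc i) = z′≤x i

window-snoc : ∀ f i l → window f i (suc l) ≡ window f i l + f (i + l)
window-snoc f i zero    = trans (+-identityʳ (f i)) (cong f (sym (+-identityʳ i)))
window-snoc f i (suc l) = begin
  f i + window f (suc i) (suc l)      ≡⟨ cong (f i +_) (window-snoc f (suc i) l) ⟩
  f i + (window f (suc i) l + f (suc i + l)) ≡⟨ sym (+-assoc (f i) _ _) ⟩
  f i + window f (suc i) l + f (suc i + l)   ≡⟨ cong (λ j → window f i (suc l) + f j) (sym (+-suc i l)) ⟩
  window f i (suc l) + f (i + suc l)  ∎
  where open ≡-Reasoning

window-+ : ∀ f i a b → window f i (a + b) ≡ window f i a + window f (i + a) b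
window-+ f i zero    b = cong (λ j → window f j b) (sym (+-identityʳ i))
window-+ f i (suc a) b = begin
  f i + window f (suc i) (a + b)                           ≡⟨ cong (f i +_) (window-+ f (suc i) a b) ⟩
  f i + (window f (suc i) a + window f (suc i + a) b)      ≡⟨ sym (+-assoc (f i) _ _) ⟩
  window f i (suc a) + window f (suc i + a) b              ≡⟨ cong (λ j → window f i (suc a) + window f j b) (sym (+-suc i a)) ⟩
  window f i (suc a) + window f (i + suc a) b              ∎
  where open ≡-Reasoning

window-shift : ∀ f h i i′ l → (∀ j → f (i + j) ≡ h (i′ + j)) → window f i l ≡ window h i′ l
window-shift f h i i′ zero    eq = refl
window-shift f h i i′ (suc l) eq =
  cong₂ _+_ (trans (cong f (sym (+-identityʳ i))) (trans (eq 0) (cong h (+-identityʳ i′))))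
            (window-shift f h (suc i) (suc i′) l
              (λ j → trans (cong f (sym (+-suc i j))) (trans (eq (suc j)) (cong h (+-suc i′ j)))))

window-≤-* : ∀ f B i l → (∀ j → f j ≤ B) → window f i l ≤ l * B
window-≤-* f B i zero    f≤B = z≤n
window-≤-* f B i (suc l) f≤B = +-mono-≤ (f≤B i) (window-≤-* f B (suc i) l f≤B)

head≤window : ∀ f i {l} → 1 ≤ l → f i ≤ window f i l
head≤window f i {suc l} _ = m≤m+n (f i) _

window-Σᶠ : ∀ k (a : Fin k → ℕ) h i → (∀ (j : Fin k) → h (i + toℕ j) ≡ a j) → window h i k ≡ Σᶠ k a
window-Σᶠ zero    a h i eq = refl
window-Σᶠ (suc k) a h i eq =
  cong₂ _+_ (trans (cong h (sym (+-identityʳ i))) (eq Fin.zero))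
            (window-Σᶠ k (a ∘ Fin.suc) h (suc i) (λ j → trans (cong h (sym (+-suc i (toℕ j)))) (eq (Fin.suc j))))

module _ (n : ℕ) .⦃ _ : NonZero n ⦄ where

  toℕ-mod : ∀ a → toℕ (a mod n) ≡ a % n
  toℕ-mod a = toℕ-fromℕ< _

  %-≡⇒mod-≡ : ∀ a b → a % n ≡ b % n → a mod n ≡ b mod n
  %-≡⇒mod-≡ a b eq = toℕ-injective (trans (toℕ-mod a) (trans eq (sym (toℕ-mod b))))

  [m+n]mod-n≡m-mod-n : ∀ a → (a + n) mod n ≡ a mod n
  [m+n]mod-n≡m-mod-n a = %-≡⇒mod-≡ (a + n) a ([m+n]%n≡m%n a n)

  toℕ-mod-n≡id : ∀ (j : Fin n) → toℕ j mod n ≡ j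
  toℕ-mod-n≡id j = toℕ-injective (trans (toℕ-mod (toℕ j)) (m<n⇒m%n≡m (toℕ<n j)))

  [toℕ[a-mod-n]+j]mod-n : ∀ a j → (toℕ (a mod n) + j) mod n ≡ (a + j) mod n
  [toℕ[a-mod-n]+j]mod-n a j = %-≡⇒mod-≡ _ _ (begin
    (toℕ (a mod n) + j) % n   ≡⟨ cong (λ z → (z + j) % n) (toℕ-mod a) ⟩
    (a % n + j) % n           ≡⟨ %-distribˡ-+ (a % n) j n ⟩
    (a % n % n + j % n) % n   ≡⟨ cong (λ z → (z + j % n) % n) (m%n%n≡m%n a n) ⟩
    (a % n + j % n) % n       ≡⟨ sym (%-distribˡ-+ a j n) ⟩
    (a + j) % n               ∎)
    where open ≡-Reasoning

  module Periodic (c : ℕ → ℕ) (periodic : ∀ j → c (j + n) ≡ c j) where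

    window-+n : ∀ i l → window c (i + n) l ≡ window c i l
    window-+n i l = window-shift c c (i + n) i l (λ j → trans (cong c (xy∙z≈xz∙y i n j)) (periodic (i + j)))

    window-+k*n : ∀ k i l → window c (i + k * n) l ≡ window c i l
    window-+k*n zero    i l = cong (λ j → window c j l) (+-identityʳ i)
    window-+k*n (suc k) i l = begin
      window c (i + (n + k * n)) l  ≡⟨ cong (λ j → window c j l) (x∙yz≈xz∙y i n (k * n)) ⟩
      window c (i + k * n + n) l    ≡⟨ window-+n (i + k * n) l ⟩
      window c (i + k * n) l        ≡⟨ window-+k*n k i l ⟩
      window c i l                  ∎
      where open ≡-Reasoning

    window-mod : ∀ t l → window c t l ≡ window c (t % n) l
    window-mod t l = trans (cong (λ j → window c j l) (m≡m%n+[m/n]*n t n))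
                           (window-+k*n (t / n) (t % n) l)

    window-period-suc : ∀ i → window c (suc i) n ≡ window c i n
    window-period-suc i = +-cancelʳ-≡ (c i) _ _ (begin
      window c (suc i) n + c i      ≡⟨ +-comm _ (c i) ⟩
      window c i (suc n)            ≡⟨ window-snoc c i n ⟩
      window c i n + c (i + n)      ≡⟨ cong (window c i n +_) (periodic i) ⟩
      window c i n + c i            ∎)
      where open ≡-Reasoning

    window-period : ∀ i → window c i n ≡ window c 0 n
    window-period zero    = refl
    window-period (suc i) = trans (window-period-suc i) (window-period i)

  window-period-Σᶠ : ∀ (h : Fin n → ℕ) t → window (h ∘ (_mod n)) t n ≡ Σᶠ n h
  window-period-Σᶠ h t =
    trans (Periodic.window-period (h ∘ (_mod n)) (cong h ∘ [m+n]mod-n≡m-mod-n) t)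
          (window-Σᶠ n h (h ∘ (_mod n)) 0 (cong h ∘ toℕ-mod-n≡id))

⌈n/2⌉≡⌊n/2⌋⊎⌈n/2⌉≡1+⌊n/2⌋ : ∀ n → ⌈ n /2⌉ ≡ ⌊ n /2⌋ ⊎ ⌈ n /2⌉ ≡ suc ⌊ n /2⌋
⌈n/2⌉≡⌊n/2⌋⊎⌈n/2⌉≡1+⌊n/2⌋ zero          = inj₁ refl
⌈n/2⌉≡⌊n/2⌋⊎⌈n/2⌉≡1+⌊n/2⌋ (suc zero)    = inj₂ refl
⌈n/2⌉≡⌊n/2⌋⊎⌈n/2⌉≡1+⌊n/2⌋ (suc (suc n)) with ⌈n/2⌉≡⌊n/2⌋⊎⌈n/2⌉≡1+⌊n/2⌋ n
... | inj₁ eq = inj₁ (cong suc eq)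
... | inj₂ eq = inj₂ (cong suc eq)

⌈n/2⌉≤1+⌊n/2⌋ : ∀ n → ⌈ n /2⌉ ≤ suc ⌊ n /2⌋
⌈n/2⌉≤1+⌊n/2⌋ n with ⌈n/2⌉≡⌊n/2⌋⊎⌈n/2⌉≡1+⌊n/2⌋ n
... | inj₁ eq = ≤-trans (≤-reflexive eq) (n≤1+n _)
... | inj₂ eq = ≤-reflexive eq

n≤⌈n/2⌉+⌈n/2⌉ : ∀ n → n ≤ ⌈ n /2⌉ + ⌈ n /2⌉
n≤⌈n/2⌉+⌈n/2⌉ n = subst (_≤ ⌈ n /2⌉ + ⌈ n /2⌉) (⌊n/2⌋+⌈n/2⌉≡n n) (+-monoˡ-≤ ⌈ n /2⌉ (⌊n/2⌋≤⌈n/2⌉ n))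

⌈n/2⌉+⌈n/2⌉≤1+n : ∀ n → ⌈ n /2⌉ + ⌈ n /2⌉ ≤ suc n
⌈n/2⌉+⌈n/2⌉≤1+n n = subst (⌈ n /2⌉ + ⌈ n /2⌉ ≤_) (cong suc (⌊n/2⌋+⌈n/2⌉≡n n)) (+-monoˡ-≤ ⌈ n /2⌉ (⌈n/2⌉≤1+⌊n/2⌋ n))

2*m≤2*n+1⇒m≤n : ∀ m n → 2 * m ≤ 2 * n + 1 → m ≤ n
2*m≤2*n+1⇒m≤n m n 2m≤2n+1 =
  ≤-pred (*-cancelˡ-< 2 m (suc n) (≤-trans (s≤s 2m≤2n+1) (≤-reflexive (2+2*n≡2*[1+n] n))))
  where
  2+2*n≡2*[1+n] : ∀ n → suc (2 * n + 1) ≡ 2 * suc n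
  2+2*n≡2*[1+n] = solve-∀

record Split (k : ℕ) (x : Fin k → ℕ) (K : ℕ) : Set where
  constructor split
  field
    keep send : Fin k → ℕ
    fits      : ∀ i → keep i + 2 * send i ≤ x i
    keeps-K   : K ≤ Σᶠ k keep
    wastes-≤1 : Σᶠ k x ≤ K + 1 + 2 * Σᶠ k send

module _ (k : ℕ) (x : Fin k → ℕ) where

  private
    odd pairs : Fin k → ℕ
    odd   i = x i % 2
    pairs i = x i / 2

    x≡odd+2*pairs : ∀ i → x i ≡ odd i + 2 * pairs i
    x≡odd+2*pairs i = trans (m≡m%n+[m/n]*n (x i) 2) (cong (odd i +_) (*-comm (pairs i) 2))

    Σx≡Σodd+2*Σpairs : Σᶠ k x ≡ Σᶠ k odd + 2 * Σᶠ k pairs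
    Σx≡Σodd+2*Σpairs = trans (Σᶠ-cong k x≡odd+2*pairs)
                             (trans (Σᶠ-+ k odd _) (cong (Σᶠ k odd +_) (Σᶠ-*ˡ k 2 pairs)))

    Σodd≤k : Σᶠ k odd ≤ k
    Σodd≤k = subst (Σᶠ k odd ≤_) (trans (Σᶠ-const k 1) (*-identityʳ k))
                   (Σᶠ-mono k (λ i → ≤-pred (m%n<n (x i) 2)))

    module _ (K : ℕ) (Σodd≤K : Σᶠ k odd ≤ K) where

      h = ⌈ (K ∸ Σᶠ k odd) /2⌉

      Σodd+[K∸Σodd]≡K : Σᶠ k odd + (K ∸ Σᶠ k odd) ≡ K
      Σodd+[K∸Σodd]≡K = m+[n∸m]≡n Σodd≤K

      keep-pairs : ∃[ u ] ((∀ i → u i ≤ pairs i) × Σᶠ k u ≡ h) → Split k x K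
      keep-pairs (u , u≤pairs , Σu≡h) = split keep send fits keeps-K wastes-≤1
        where
        keep send : Fin k → ℕ
        keep i = odd i + 2 * u i
        send i = pairs i ∸ u i
        fits : ∀ i → keep i + 2 * send i ≤ x i
        fits i = ≤-reflexive (begin
          odd i + 2 * u i + 2 * send i   ≡⟨ +-assoc (odd i) _ _ ⟩
          odd i + (2 * u i + 2 * send i) ≡⟨ cong (odd i +_) (sym (*-distribˡ-+ 2 (u i) _)) ⟩
          odd i + 2 * (u i + send i)     ≡⟨ cong (λ z → odd i + 2 * z) (m+[n∸m]≡n (u≤pairs i)) ⟩
          odd i + 2 * pairs i            ≡⟨ sym (x≡odd+2*pairs i) ⟩
          x i                            ∎)
          where open ≡-Reasoning
        Σkeep≡Σodd+2h : Σᶠ k keep ≡ Σᶠ k odd + 2 * h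
        Σkeep≡Σodd+2h = trans (Σᶠ-+ k odd _) (cong (Σᶠ k odd +_) (trans (Σᶠ-*ˡ k 2 u) (cong (2 *_) Σu≡h)))
        keeps-K : K ≤ Σᶠ k keep
        keeps-K = begin
          K                          ≡⟨ sym Σodd+[K∸Σodd]≡K ⟩
          Σᶠ k odd + (K ∸ Σᶠ k odd)  ≤⟨ +-monoʳ-≤ (Σᶠ k odd) (≤-trans (n≤⌈n/2⌉+⌈n/2⌉ _) (≤-reflexive (sym (2*m≡m+m h)))) ⟩
          Σᶠ k odd + 2 * h           ≡⟨ sym Σkeep≡Σodd+2h ⟩
          Σᶠ k keep                  ∎
          where
          open ≤-Reasoning
          2*m≡m+m : ∀ m → 2 * m ≡ m + m
          2*m≡m+m = solve-∀
        Σpairs≡h+Σsend : Σᶠ k pairs ≡ h + Σᶠ k send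
        Σpairs≡h+Σsend = trans (Σᶠ-cong k (λ i → sym (m+[n∸m]≡n (u≤pairs i))))
                               (trans (Σᶠ-+ k u send) (cong (_+ Σᶠ k send) Σu≡h))
        wastes-≤1 : Σᶠ k x ≤ K + 1 + 2 * Σᶠ k send
        wastes-≤1 = begin
          Σᶠ k x                                     ≡⟨ Σx≡Σodd+2*Σpairs ⟩
          Σᶠ k odd + 2 * Σᶠ k pairs                  ≡⟨ cong (λ z → Σᶠ k odd + 2 * z) Σpairs≡h+Σsend ⟩
          Σᶠ k odd + 2 * (h + Σᶠ k send)             ≡⟨ regroup (Σᶠ k odd) h (Σᶠ k send) ⟩
          Σᶠ k odd + (h + h) + 2 * Σᶠ k send         ≤⟨ +-monoˡ-≤ _ (+-monoʳ-≤ (Σᶠ k odd) (⌈n/2⌉+⌈n/2⌉≤1+n _)) ⟩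
          Σᶠ k odd + suc (K ∸ Σᶠ k odd) + 2 * Σᶠ k send ≡⟨ cong (_+ 2 * Σᶠ k send) (trans (+-suc (Σᶠ k odd) _) (cong suc Σodd+[K∸Σodd]≡K)) ⟩
          suc K + 2 * Σᶠ k send                      ≡⟨ cong (_+ 2 * Σᶠ k send) (+-comm 1 K) ⟩
          K + 1 + 2 * Σᶠ k send                      ∎
          where
          open ≤-Reasoning
          regroup : ∀ a b c → a + 2 * (b + c) ≡ a + (b + b) + 2 * c
          regroup = solve-∀

      keep-all : K ≤ Σᶠ k x → Σᶠ k pairs < h → Split k x K
      keep-all K≤Σx Σpairs<h = split x (λ _ → 0) (λ i → ≤-reflexive (+-identityʳ (x i))) K≤Σx
                                 (≤-trans Σx≤K (≤-trans (m≤m+n K 1) (m≤m+n _ _)))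
        where
        2Σpairs≤K∸Σodd : 2 * Σᶠ k pairs ≤ K ∸ Σᶠ k odd
        2Σpairs≤K∸Σodd = <⇒≤ (≤-pred (begin
          2 + 2 * Σᶠ k pairs                    ≡⟨ 2+2*m≡[1+m]+[1+m] (Σᶠ k pairs) ⟩
          suc (Σᶠ k pairs) + suc (Σᶠ k pairs)   ≤⟨ +-mono-≤ Σpairs<h Σpairs<h ⟩
          h + h                                 ≤⟨ ⌈n/2⌉+⌈n/2⌉≤1+n _ ⟩
          suc (K ∸ Σᶠ k odd)                    ∎))
          where
          open ≤-Reasoning
          2+2*m≡[1+m]+[1+m] : ∀ m → 2 + 2 * m ≡ suc m + suc m
          2+2*m≡[1+m]+[1+m] = solve-∀
        Σx≤K : Σᶠ k x ≤ K
        Σx≤K = begin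
          Σᶠ k x                     ≡⟨ Σx≡Σodd+2*Σpairs ⟩
          Σᶠ k odd + 2 * Σᶠ k pairs  ≤⟨ +-monoʳ-≤ (Σᶠ k odd) 2Σpairs≤K∸Σodd ⟩
          Σᶠ k odd + (K ∸ Σᶠ k odd)  ≡⟨ Σodd+[K∸Σodd]≡K ⟩
          K                          ∎
          where open ≤-Reasoning

  -- Every vertex keeps its odd pebble (hence k ≤ K); pairs are kept until at least K pebbles stay.
  split-keep-send : ∀ K → k ≤ K → K ≤ Σᶠ k x → Split k x K
  split-keep-send K k≤K K≤Σx with h K (≤-trans Σodd≤k k≤K) ≤? Σᶠ k pairs
  ... | yes h≤Σpairs = keep-pairs K (≤-trans Σodd≤k k≤K) (Σᶠ-select k pairs _ h≤Σpairs)
  ... | no  h≰Σpairs = keep-all K (≤-trans Σodd≤k k≤K) K≤Σx (≰⇒> h≰Σpairs)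

-- Reachability

module Pebbling {V : Set} (Adj : V → V → Set) where

  Step = PebblingStep Adj

  infix  4 _≤ᵈ_
  infixr 6 _⊕_

  _≤ᵈ_ : (V → ℕ) → (V → ℕ) → Set
  D ≤ᵈ E = ∀ v → D v ≤ E v

  _⊕_ : (V → ℕ) → (V → ℕ) → V → ℕ
  (D ⊕ E) v = D v + E v

  Reach : (V → ℕ) → (V → ℕ) → Set
  Reach D E = ∃[ D′ ] (Star Step D D′ × E ≤ᵈ D′)

  step-⊕ʳ : ∀ {D D′} X → Step D D′ → Step (D ⊕ X) (D′ ⊕ X)
  step-⊕ʳ {D} {D′} X (u , v , u~v , 2≤Du , D′u+2≡Du , D′v≡1+Dv , others) =
    u , v , u~v , ≤-trans 2≤Du (m≤m+n (D u) (X u))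
    , trans (xy∙z≈xz∙y (D′ u) (X u) 2) (cong (_+ X u) D′u+2≡Du)
    , cong (_+ X v) D′v≡1+Dv
    , λ w w≢u w≢v → cong (_+ X w) (others w w≢u w≢v)

  reach-⊕ʳ : ∀ {D E} X → Reach D E → Reach (D ⊕ X) (E ⊕ X)
  reach-⊕ʳ X (D′ , steps , E≤D′) =
    D′ ⊕ X , gmap (_⊕ X) (step-⊕ʳ X) steps , λ v → +-monoˡ-≤ (X v) (E≤D′ v)

  private
    step-resp-≗ : ∀ {D D₀ D′} → (∀ v → D v ≡ D₀ v) → Step D D′ → Step D₀ D′
    step-resp-≗ D≗D₀ (u , v , u~v , 2≤Du , D′u+2≡Du , D′v≡1+Dv , others) =
      u , v , u~v , subst (2 ≤_) (D≗D₀ u) 2≤Du , trans D′u+2≡Du (D≗D₀ u)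
      , trans D′v≡1+Dv (cong suc (D≗D₀ v)) , λ w w≢u w≢v → trans (others w w≢u w≢v) (D≗D₀ w)

    reach-resp-≗ : ∀ {D D₀ E} → (∀ v → D v ≡ D₀ v) → Reach D E → Reach D₀ E
    reach-resp-≗ {D₀ = D₀} D≗D₀ (_ , ε , E≤D)          = D₀ , ε , λ v → subst (_ ≤_) (D≗D₀ v) (E≤D v)
    reach-resp-≗ D≗D₀ (D′ , step ◅ steps , E≤D′) = D′ , step-resp-≗ D≗D₀ step ◅ steps , E≤D′

  reach-refl : ∀ {D E} → E ≤ᵈ D → Reach D E
  reach-refl {D} E≤D = D , ε , E≤D

  reach-weaken : ∀ {D D₀ E E₀} → D ≤ᵈ D₀ → E₀ ≤ᵈ E → Reach D E → Reach D₀ E₀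
  reach-weaken {D} {D₀} D≤D₀ E₀≤E reach
    with reach-resp-≗ (λ v → trans (+-comm (D v) _) (m∸n+n≡m (D≤D₀ v))) (reach-⊕ʳ (λ v → D₀ v ∸ D v) reach)
  ... | D′ , steps , E+X≤D′ = D′ , steps , λ v → ≤-trans (E₀≤E v) (≤-trans (m≤m+n _ _) (E+X≤D′ v))

  reach-trans : ∀ {D E F} → Reach D E → Reach E F → Reach D F
  reach-trans (D′ , steps , E≤D′) reach with reach-weaken E≤D′ (λ v → ≤-refl) reach
  ... | D″ , steps′ , F≤D″ = D″ , steps ◅◅ steps′ , F≤D″

  reach-⊕ : ∀ {A B C E} → Reach A B → Reach C E → Reach (A ⊕ C) (B ⊕ E)
  reach-⊕ {A} {B} {C} {E} A→B C→E =
    reach-trans (reach-⊕ʳ C A→B)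
      (reach-weaken (λ v → ≤-reflexive (+-comm (C v) (B v))) (λ v → ≤-reflexive (+-comm (B v) (E v)))
        (reach-⊕ʳ B C→E))

  module Reach-Reasoning where

    infix  3 _∎
    infixr 2 _→⟨_⟩_ _≥⟨_⟩_

    _→⟨_⟩_ : ∀ D {E F} → Reach D E → Reach E F → Reach D F
    D →⟨ D→E ⟩ E→F = reach-trans D→E E→F

    _≥⟨_⟩_ : ∀ D {E F} → E ≤ᵈ D → Reach E F → Reach D F
    D ≥⟨ E≤D ⟩ E→F = reach-weaken E≤D (λ v → ≤-refl) E→F

    _∎ : ∀ D → Reach D D
    D ∎ = reach-refl (λ v → ≤-refl)

  reach-Σᶠ : ∀ k {A B : Fin k → V → ℕ} → (∀ i → Reach (A i) (B i)) →
             Reach (λ v → Σᶠ k (λ i → A i v)) (λ v → Σᶠ k (λ i → B i v))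
  reach-Σᶠ zero    reaches = reach-refl (λ v → z≤n)
  reach-Σᶠ (suc k) reaches = reach-⊕ (reaches Fin.zero) (reach-Σᶠ k (reaches ∘ Fin.suc))

module _ (G : Graph) where

  open Graph G
  open Pebbling Adj

  Σᶠ-step : ∀ {x x′} → Step x x′ → Σᶠ size x′ + 1 ≡ Σᶠ size x
  Σᶠ-step {x} {x′} (u , v , u~v , _ , x′u+2≡xu , x′v≡1+xv , others) =
    +-cancelʳ-≡ 1 _ _ (begin
      Σᶠ size x′ + 1 + 1                                     ≡⟨ +-assoc (Σᶠ size x′) 1 1 ⟩
      Σᶠ size x′ + 2                                         ≡⟨ cong (Σᶠ size x′ +_) (sym (Σᶠ-indicator size (λ _ → 2) u)) ⟩
      Σᶠ size x′ + Σᶠ size (λ w → indicator w u 2)           ≡⟨ sym (Σᶠ-+ size x′ _) ⟩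
      Σᶠ size (λ w → x′ w + indicator w u 2)                 ≡⟨ Σᶠ-cong size balance ⟩
      Σᶠ size (λ w → x w + indicator w v 1)                  ≡⟨ Σᶠ-+ size x _ ⟩
      Σᶠ size x + Σᶠ size (λ w → indicator w v 1)            ≡⟨ cong (Σᶠ size x +_) (Σᶠ-indicator size (λ _ → 1) v) ⟩
      Σᶠ size x + 1                                          ∎)
    where
    open ≡-Reasoning
    balance : ∀ w → x′ w + indicator w u 2 ≡ x w + indicator w v 1
    balance w with w Fin.≟ u | w Fin.≟ v
    ... | yes refl | yes refl = ⊥-elim (adj-irrefl u~v)
    ... | yes refl | no _     = trans x′u+2≡xu (sym (+-identityʳ _))
    ... | no _     | yes refl = trans (+-identityʳ _) (trans x′v≡1+xv (+-comm 1 _))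
    ... | no w≢u   | no w≢v   = cong₂ _+_ (others w w≢u w≢v) refl

  Σᶠ-steps : ∀ {x x′} → Star Step x x′ → Σᶠ size x′ ≤ Σᶠ size x
  Σᶠ-steps ε              = ≤-refl
  Σᶠ-steps (step ◅ steps) = ≤-trans (Σᶠ-steps steps) (≤-trans (m≤m+n _ 1) (≤-reflexive (Σᶠ-step step)))

  size≤cover-number : ∀ {Q} → AllCoverable G Q → size ≤ Q
  size≤cover-number {Q} allCoverable with 1 ≤? size
  ... | no size≱1 = ≤-trans (≤-pred (≰⇒> size≱1)) z≤n
  ... | yes size≥1 with allCoverable (λ w → indicator w u Q) (Σᶠ-indicator size (λ _ → Q) u)
    where u = Fin.fromℕ< size≥1
  ... | x′ , steps , covered =
    ≤-trans (size≤Σᶠ size covered)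
            (≤-trans (Σᶠ-steps steps) (≤-reflexive (Σᶠ-indicator size (λ _ → Q) (Fin.fromℕ< size≥1))))

-- Covering arcs of G □ C_n

base-budget : ∀ Q mm a b → Q * 2 + mm * 1 ≤ Q + (a + (b + 0)) → Q + mm ≤ a + b
base-budget Q mm a b budget = +-cancelˡ-≤ Q _ _ (subst₂ _≤_ (regroup Q mm) (cong (λ z → Q + (a + z)) (+-identityʳ b)) budget)
  where
  regroup : ∀ Q mm → Q * 2 + mm * 1 ≡ Q + (Q + mm)
  regroup = solve-∀

surplus-budget : ∀ Q E .⦃ _ : NonZero E ⦄ mm a s W → Q * (2 * E) + mm * E ≤ Q + (a + W) →
                 a ≤ Q + mm + 1 + 2 * s → Q * E ≤ Q + (s + W)
surplus-budget Q E mm a s W budget a≤ = 2*m≤2*n+1⇒m≤n (Q * E) (Q + (s + W)) (+-cancelʳ-≤ mm _ _ (begin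
  2 * (Q * E) + mm                  ≡⟨ cong (_+ mm) (*-left-comm 2 Q E) ⟩
  Q * (2 * E) + mm                  ≤⟨ +-monoʳ-≤ (Q * (2 * E)) (m≤m*n mm E) ⟩
  Q * (2 * E) + mm * E              ≤⟨ budget ⟩
  Q + (a + W)                       ≤⟨ +-monoʳ-≤ Q (+-monoˡ-≤ W a≤) ⟩
  Q + (Q + mm + 1 + 2 * s + W)      ≤⟨ m≤m+n _ W ⟩
  Q + (Q + mm + 1 + 2 * s + W) + W  ≡⟨ regroup Q mm s W ⟩
  2 * (Q + (s + W)) + 1 + mm        ∎))
  where
  open ≤-Reasoning
  regroup : ∀ Q mm s W → Q + (Q + mm + 1 + 2 * s + W) + W ≡ 2 * (Q + (s + W)) + 1 + mm
  regroup = solve-∀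

deficit-budget : ∀ Q E .⦃ _ : NonZero E ⦄ mm a d W → a + d ≡ Q + mm →
                 Q * (2 * (2 * E)) + mm * (2 * E) ≤ Q + (a + W) → Q * (2 * E) + (2 * d) * E ≤ Q + W
deficit-budget Q E mm a d W a+d≡Q+mm budget = +-cancelʳ-≤ (a * (2 * E)) _ _ (begin
  Q * (2 * E) + 2 * d * E + a * (2 * E)   ≡⟨ regroup₁ Q E d a ⟩
  Q * (2 * E) + (a + d) * (2 * E)         ≡⟨ cong (λ z → Q * (2 * E) + z * (2 * E)) a+d≡Q+mm ⟩
  Q * (2 * E) + (Q + mm) * (2 * E)        ≡⟨ regroup₂ Q E mm ⟩
  Q * (2 * (2 * E)) + mm * (2 * E)        ≤⟨ budget ⟩
  Q + (a + W)                             ≡⟨ x∙yz≈xz∙y Q a W ⟩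
  Q + W + a                               ≤⟨ +-monoʳ-≤ (Q + W) (m≤m*n a (2 * E) ⦃ m*n≢0 2 E ⦄) ⟩
  Q + W + a * (2 * E)                     ∎)
  where
  open ≤-Reasoning
  regroup₁ : ∀ Q E d a → Q * (2 * E) + 2 * d * E + a * (2 * E) ≡ Q * (2 * E) + (a + d) * (2 * E)
  regroup₁ = solve-∀
  regroup₂ : ∀ Q E mm → Q * (2 * E) + (Q + mm) * (2 * E) ≡ Q * (2 * (2 * E)) + mm * (2 * E)
  regroup₂ = solve-∀

deficit-repaid : ∀ Q mm a d y s → a + d ≡ Q + mm → Q + 2 * d ≤ y → y ≤ Q + 1 + 2 * s → Q + mm ≤ a + s
deficit-repaid Q mm a d y s a+d≡Q+mm Q+2d≤y y≤ =
  subst (_≤ a + s) a+d≡Q+mm (+-monoʳ-≤ a (2*m≤2*n+1⇒m≤n d s (+-cancelˡ-≤ Q _ _ (begin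
    Q + 2 * d          ≤⟨ ≤-trans Q+2d≤y y≤ ⟩
    Q + 1 + 2 * s      ≡⟨ xy∙z≈x∙zy Q 1 (2 * s) ⟩
    Q + (2 * s + 1)    ∎))))
  where open ≤-Reasoning

-- On C₁ the wrap-around clause of CycAdj makes the vertex its own neighbour, hence n = 2 + m.
module Product (G : Graph) (m : ℕ) (Q : ℕ) (allCoverable : AllCoverable G Q) where

  g = Graph.size G
  n = 2 + m

  open Pebbling (ProdAdj G n)
  module OnG = Pebbling (Graph.Adj G)

  layer : Fin n → (Fin g → ℕ) → Fin g × Fin n → ℕ
  layer p x (w , j) = indicator p j (x w)

  layer-diag : ∀ p x w → layer p x (w , p) ≡ x w
  layer-diag p x w = indicator-diag p (x w)

  layer-+ : ∀ p x y v → layer p (λ w → x w + y w) v ≡ layer p x v + layer p y v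
  layer-+ p x y (w , j) = indicator-+ p j (x w) (y w)

  layer-zero : ∀ p v → layer p (λ _ → 0) v ≡ 0
  layer-zero p (w , j) = indicator-zero p j

  layer-mono : ∀ p {x y} → (∀ w → x w ≤ y w) → layer p x ≤ᵈ layer p y
  layer-mono p x≤y (w , j) with does (p Fin.≟ j)
  ... | true  = x≤y w
  ... | false = z≤n

  layer-resp-≗ : ∀ p {x y} → (∀ w → x w ≡ y w) → ∀ v → layer p x v ≡ layer p y v
  layer-resp-≗ p x≗y (w , j) = cong (indicator p j) (x≗y w)

  layer-step : ∀ p {x x′} → OnG.Step x x′ → Step (layer p x) (layer p x′)
  layer-step p {x} {x′} (u , v , u~v , 2≤xu , x′u+2≡xu , x′v≡1+xv , others) =
    (u , p) , (v , p) , inj₂ (u~v , refl)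
    , subst (2 ≤_) (sym (layer-diag p x u)) 2≤xu
    , trans (cong (_+ 2) (layer-diag p x′ u)) (trans x′u+2≡xu (sym (layer-diag p x u)))
    , trans (layer-diag p x′ v) (trans x′v≡1+xv (cong suc (sym (layer-diag p x v))))
    , unchanged
    where
    unchanged : ∀ wj → wj ≢ (u , p) → wj ≢ (v , p) → layer p x′ wj ≡ layer p x wj
    unchanged (w , j) ≢u ≢v with p Fin.≟ j
    ... | yes refl = others w (≢u ∘ cong (_, p)) (≢v ∘ cong (_, p))
    ... | no  _    = refl

  reach-layer : ∀ p {x y} → OnG.Reach x y → Reach (layer p x) (layer p y)
  reach-layer p (x′ , steps , y≤x′) = layer p x′ , gmap (layer p) (layer-step p) steps , layer-mono p y≤x′

  cover-layer : ∀ p x → Q ≤ Σᶠ g x → Reach (layer p x) (layer p (λ _ → 1))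
  cover-layer p x Q≤Σx with Σᶠ-select g x Q Q≤Σx
  ... | z , z≤x , Σz≡Q = reach-layer p (OnG.reach-weaken z≤x (λ w → ≤-refl) (allCoverable z Σz≡Q))

  CycAdj-sym : ∀ {p q} → CycAdj n p q → CycAdj n q p
  CycAdj-sym (inj₁ q≡1+p)                 = inj₂ (inj₁ q≡1+p)
  CycAdj-sym (inj₂ (inj₁ p≡1+q))          = inj₁ p≡1+q
  CycAdj-sym (inj₂ (inj₂ (inj₁ wrap)))    = inj₂ (inj₂ (inj₂ wrap))
  CycAdj-sym (inj₂ (inj₂ (inj₂ wrap)))    = inj₂ (inj₂ (inj₁ wrap))

  CycAdj⇒≢ : ∀ {p q} → CycAdj n p q → p ≢ q
  CycAdj⇒≢ (inj₁ q≡1+p)                        refl = 1+n≢n (sym q≡1+p)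
  CycAdj⇒≢ (inj₂ (inj₁ p≡1+q))                 refl = 1+n≢n (sym p≡1+q)
  CycAdj⇒≢ (inj₂ (inj₂ (inj₁ (p≡0 , 1+q≡n))))  refl = 0≢1+n (suc-injective (trans (cong suc (sym p≡0)) 1+q≡n))
  CycAdj⇒≢ (inj₂ (inj₂ (inj₂ (q≡0 , 1+p≡n))))  refl = 0≢1+n (suc-injective (trans (cong suc (sym q≡0)) 1+p≡n))

  pos : ℕ → Fin n
  pos t = t mod n

  toℕ-pos-suc : ∀ t → toℕ (pos (suc t)) ≡ suc (t % n) % n
  toℕ-pos-suc t = trans (toℕ-mod n (suc t))
    (trans (cong (λ z → suc z % n) (m≡m%n+[m/n]*n t n)) ([m+kn]%n≡m%n (suc (t % n)) (t / n) n))

  CycAdj-pos : ∀ t → CycAdj n (pos t) (pos (suc t))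
  CycAdj-pos t with suc (t % n) <? n
  ... | yes 1+r<n = inj₁ (trans (toℕ-pos-suc t) (trans (m<n⇒m%n≡m 1+r<n) (cong suc (sym (toℕ-mod n t)))))
  ... | no  1+r≮n = inj₂ (inj₂ (inj₂ (trans (toℕ-pos-suc t) (trans (cong (_% n) 1+r≡n) (n%n≡0 n))
                                       , trans (cong suc (toℕ-mod n t)) 1+r≡n)))
    where 1+r≡n = ≤-antisym (m%n<n t n) (≮⇒≥ 1+r≮n)

  single : Fin g → ℕ → Fin g → ℕ
  single w c w′ = indicator w w′ c

  layer-single-off : ∀ p w c v → v ≢ (w , p) → layer p (single w c) v ≡ 0
  layer-single-off p w c (w′ , j) v≢wp with p Fin.≟ j
  ... | no  _    = refl
  ... | yes refl with w Fin.≟ w′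
  ...   | yes refl = ⊥-elim (v≢wp refl)
  ...   | no  _    = refl

  layer-single-diag : ∀ p w c → layer p (single w c) (w , p) ≡ c
  layer-single-diag p w c = trans (layer-diag p (single w c) w) (indicator-diag w c)

  layer-Σᶠ-single : ∀ p x v → layer p x v ≡ Σᶠ g (λ w → layer p (single w (x w)) v)
  layer-Σᶠ-single p x (w′ , j) with does (p Fin.≟ j)
  ... | true  = sym (Σᶠ-indicator g x w′)
  ... | false = sym (Σᶠ-zero g)

  move-pebble : ∀ {p q} w → CycAdj n p q → Reach (layer p (single w 2)) (layer q (single w 1))
  move-pebble {p} {q} w p~q = _ , step ◅ ε , λ v → ≤-refl
    where
    p≢q = CycAdj⇒≢ p~q
    step : Step (layer p (single w 2)) (layer q (single w 1))
    step = (w , p) , (w , q) , inj₁ (refl , p~q)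
      , ≤-reflexive (sym (layer-single-diag p w 2))
      , trans (cong (_+ 2) (layer-single-off q w 1 (w , p) (p≢q ∘ cong proj₂))) (sym (layer-single-diag p w 2))
      , trans (layer-single-diag q w 1) (cong suc (sym (layer-single-off p w 2 (w , q) (p≢q ∘ sym ∘ cong proj₂))))
      , λ v v≢wp v≢wq → trans (layer-single-off q w 1 v v≢wq) (sym (layer-single-off p w 2 v v≢wp))

  move-colour : ∀ {p q} w c → CycAdj n p q → Reach (layer p (single w (2 * c))) (layer q (single w c))
  move-colour {p} {q} w zero    p~q =
    reach-refl (λ v → ≤-trans (≤-reflexive (trans (layer-resp-≗ q (indicator-zero w) v) (layer-zero q v))) z≤n)
  move-colour {p} {q} w (suc c) p~q = reach-weaken
    (λ v → ≤-reflexive (sym (trans (layer-resp-≗ p (λ w′ → trans (cong (indicator w w′) (2*[1+c]≡2+2*c c))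
                                                                    (indicator-+ w w′ 2 (2 * c))) v)
                                   (layer-+ p (single w 2) (single w (2 * c)) v))))
    (λ v → ≤-reflexive (trans (layer-resp-≗ q (λ w′ → indicator-+ w w′ 1 c) v) (layer-+ q (single w 1) (single w c) v)))
    (reach-⊕ (move-pebble w p~q) (move-colour w c p~q))
    where
    2*[1+c]≡2+2*c : ∀ c → 2 * suc c ≡ 2 + 2 * c
    2*[1+c]≡2+2*c = solve-∀

  move : ∀ {p q} → CycAdj n p q → (y : Fin g → ℕ) → Reach (layer p (λ w → 2 * y w)) (layer q y)
  move {p} {q} p~q y = reach-weaken
    (λ v → ≤-reflexive (sym (layer-Σᶠ-single p (λ w → 2 * y w) v)))
    (λ v → ≤-reflexive (layer-Σᶠ-single q y v))
    (reach-Σᶠ g (λ w → move-colour w (y w) p~q))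

  keep-and-send : ∀ {p q} → CycAdj n p q → (x keep send : Fin g → ℕ) → (∀ w → keep w + 2 * send w ≤ x w) →
                  Reach (layer p x) (layer p keep ⊕ layer q send)
  keep-and-send {p} p~q x keep send fits = reach-weaken
    (λ v → ≤-trans (≤-reflexive (sym (layer-+ p keep (λ w → 2 * send w) v))) (layer-mono p fits v))
    (λ v → ≤-refl)
    (reach-⊕ (reach-refl {layer p keep} (λ v → ≤-refl)) (move p~q send))

  arc : (ℕ → Fin g → ℕ) → ℕ → ℕ → Fin g × Fin n → ℕ
  arc x t l v = window (λ j → layer (pos j) (x j) v) t l

  covered : ℕ → ℕ → Fin g × Fin n → ℕ
  covered t l v = window (λ j → layer (pos j) (λ _ → 1) v) t l

  weight : (ℕ → Fin g → ℕ) → ℕ → ℕ → ℕ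
  weight x t l = window (λ j → Σᶠ g (x j)) t l

  Budget : ℕ → ℕ → (ℕ → Fin g → ℕ) → ℕ → (Fin g → ℕ) → Set
  Budget l mm x t e = Q * 2 ^ suc l + mm * 2 ^ l ≤ Q + (Σᶠ g e + weight x t (suc l))

  Delivers : ℕ → ℕ → (ℕ → Fin g → ℕ) → ℕ → (Fin g → ℕ) → Set
  Delivers l mm x t e = ∃[ y ] (Q + mm ≤ Σᶠ g y ×
    Reach (layer (pos t) e ⊕ arc x t (suc l)) (layer (pos t) y ⊕ covered (suc t) l))

  private
    g≤Q : g ≤ Q
    g≤Q = size≤cover-number G allCoverable

  module _ (x : ℕ → Fin g → ℕ) where

    private
      open Reach-Reasoning

      IH : ℕ → ℕ → Set
      IH l t = ∀ mm e → Budget l mm x t e → Delivers l mm x t e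

      with-fibre : (Fin g → ℕ) → ℕ → Fin g → ℕ
      with-fibre e t w = e w + x t w

      Σᶠ-with-fibre : ∀ e t l → Σᶠ g e + weight x t (suc l) ≡ Σᶠ g (with-fibre e t) + weight x (suc t) l
      Σᶠ-with-fibre e t l = trans (sym (+-assoc (Σᶠ g e) _ _)) (cong (_+ weight x (suc t) l) (sym (Σᶠ-+ g e (x t))))

      absorb-fibre : ∀ e t F → layer (pos t) (with-fibre e t) ⊕ F ≤ᵈ layer (pos t) e ⊕ (layer (pos t) (x t) ⊕ F)
      absorb-fibre e t F v = ≤-reflexive (trans (cong (_+ F v) (layer-+ (pos t) e (x t) v)) (+-assoc (layer (pos t) e v) _ (F v)))

    arc-delivers-base : ∀ mm t e → Budget 0 mm x t e → Delivers 0 mm x t e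
    arc-delivers-base mm t e budget =
      with-fibre e t
      , subst (Q + mm ≤_) (sym (Σᶠ-+ g e (x t))) (base-budget Q mm (Σᶠ g e) (Σᶠ g (x t)) budget)
      , reach-refl (absorb-fibre e t (λ _ → 0))

    surplus-step : ∀ l mm t e → IH l (suc t) → Budget (suc l) mm x t e →
                   Q + mm ≤ Σᶠ g (with-fibre e t) → Delivers (suc l) mm x t e
    surplus-step l mm t e ih budget surplus
      with split-keep-send g (with-fibre e t) (Q + mm) (≤-trans g≤Q (m≤m+n Q mm)) surplus
    ... | split keep send fits keeps-Q+mm wastes
      with ih 0 send (subst (_≤ Q + (Σᶠ g send + weight x (suc t) (suc l))) (sym (+-identityʳ _))
             (surplus-budget Q (2 ^ suc l) ⦃ m^n≢0 2 (suc l) ⦄ mm (Σᶠ g (with-fibre e t)) (Σᶠ g send) (weight x (suc t) (suc l))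
               (subst (λ z → Q * 2 ^ suc (suc l) + mm * 2 ^ suc l ≤ Q + z) (Σᶠ-with-fibre e t (suc l)) budget) wastes))
    ... | y′ , Q≤Σy′ , deliver = keep , keeps-Q+mm ,
      (layer t₀ e ⊕ arc x t (suc (suc l))
         ≥⟨ absorb-fibre e t (arc x (suc t) (suc l)) ⟩
       layer t₀ (with-fibre e t) ⊕ arc x (suc t) (suc l)
         →⟨ reach-⊕ (keep-and-send (CycAdj-pos t) (with-fibre e t) keep send fits) (arc x (suc t) (suc l) ∎) ⟩
       (layer t₀ keep ⊕ layer t₁ send) ⊕ arc x (suc t) (suc l)
         ≥⟨ (λ v → ≤-reflexive (sym (+-assoc (layer t₀ keep v) _ _))) ⟩
       layer t₀ keep ⊕ (layer t₁ send ⊕ arc x (suc t) (suc l))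
         →⟨ reach-⊕ (layer t₀ keep ∎) deliver ⟩
       layer t₀ keep ⊕ (layer t₁ y′ ⊕ covered (suc (suc t)) l)
         →⟨ reach-⊕ (layer t₀ keep ∎) (reach-⊕ (cover-layer t₁ y′ (subst (_≤ _) (+-identityʳ Q) Q≤Σy′)) (covered (suc (suc t)) l ∎)) ⟩
       layer t₀ keep ⊕ covered (suc t) (suc l) ∎)
      where
      t₀ = pos t
      t₁ = pos (suc t)

    deficit-step : ∀ l mm t e → IH l (suc t) → Budget (suc l) mm x t e →
                   Σᶠ g (with-fibre e t) < Q + mm → Delivers (suc l) mm x t e
    deficit-step l mm t e ih budget deficit
      with ih (2 * d) (λ _ → 0) (subst (λ z → Q * 2 ^ suc l + 2 * d * 2 ^ l ≤ Q + (z + weight x (suc t) (suc l)))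
                                       (sym (Σᶠ-zero g))
             (deficit-budget Q (2 ^ l) ⦃ m^n≢0 2 l ⦄ mm a d (weight x (suc t) (suc l)) a+d≡Q+mm
               (subst (λ z → Q * 2 ^ suc (suc l) + mm * 2 ^ suc l ≤ Q + z) (Σᶠ-with-fibre e t (suc l)) budget)))
      where
      a = Σᶠ g (with-fibre e t)
      d = Q + mm ∸ a
      a+d≡Q+mm = m+[n∸m]≡n (<⇒≤ deficit)
    ... | y′ , Q+2d≤Σy′ , deliver with split-keep-send g y′ Q g≤Q (≤-trans (m≤m+n Q _) Q+2d≤Σy′)
    ... | split keep send fits keeps-Q wastes =
      (λ w → with-fibre e t w + send w)
      , subst (Q + mm ≤_) (sym (Σᶠ-+ g (with-fibre e t) send))
          (deficit-repaid Q mm a d (Σᶠ g y′) (Σᶠ g send) (m+[n∸m]≡n (<⇒≤ deficit)) Q+2d≤Σy′ wastes)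
      , (layer t₀ e ⊕ arc x t (suc (suc l))
           ≥⟨ (λ v → ≤-trans (≤-reflexive (cong (λ z → layer t₀ (with-fibre e t) v + (z + arc x (suc t) (suc l) v)) (layer-zero t₁ v)))
                             (absorb-fibre e t (arc x (suc t) (suc l)) v)) ⟩
         layer t₀ (with-fibre e t) ⊕ (layer t₁ (λ _ → 0) ⊕ arc x (suc t) (suc l))
           →⟨ reach-⊕ (layer t₀ (with-fibre e t) ∎) deliver ⟩
         layer t₀ (with-fibre e t) ⊕ (layer t₁ y′ ⊕ covered (suc (suc t)) l)
           →⟨ reach-⊕ (layer t₀ (with-fibre e t) ∎) (reach-⊕ (keep-and-send (CycAdj-sym (CycAdj-pos t)) y′ keep send fits) (covered (suc (suc t)) l ∎)) ⟩
         layer t₀ (with-fibre e t) ⊕ ((layer t₁ keep ⊕ layer t₀ send) ⊕ covered (suc (suc t)) l)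
           →⟨ reach-⊕ (layer t₀ (with-fibre e t) ∎) (reach-⊕ (reach-⊕ (cover-layer t₁ keep keeps-Q) (layer t₀ send ∎)) (covered (suc (suc t)) l ∎)) ⟩
         layer t₀ (with-fibre e t) ⊕ ((layer t₁ (λ _ → 1) ⊕ layer t₀ send) ⊕ covered (suc (suc t)) l)
           ≥⟨ (λ v → ≤-reflexive (regroup v)) ⟩
         layer t₀ (λ w → with-fibre e t w + send w) ⊕ covered (suc t) (suc l) ∎)
      where
      t₀ = pos t
      t₁ = pos (suc t)
      a = Σᶠ g (with-fibre e t)
      d = Q + mm ∸ a
      regroup : ∀ v → (layer t₀ (λ w → with-fibre e t w + send w) ⊕ covered (suc t) (suc l)) v
                    ≡ (layer t₀ (with-fibre e t) ⊕ ((layer t₁ (λ _ → 1) ⊕ layer t₀ send) ⊕ covered (suc (suc t)) l)) v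
      regroup v = trans (cong (_+ _) (layer-+ t₀ (with-fibre e t) send v))
                          (rearrange (layer t₀ (with-fibre e t) v) (layer t₀ send v) (layer t₁ (λ _ → 1) v) (covered (suc (suc t)) l v))
        where
        rearrange : ∀ a b c d → (a + b) + (c + d) ≡ a + ((c + b) + d)
        rearrange = solve-∀

    -- The copy at t keeps Q + mm and sends its surplus on in pairs, or, short by d,
    -- asks the rest of the arc for 2d extra pebbles and gets d of them back.
    arc-delivers : ∀ l mm t e → Budget l mm x t e → Delivers l mm x t e
    arc-delivers zero    = arc-delivers-base
    arc-delivers (suc l) mm t e budget with Q + mm ≤? Σᶠ g (with-fibre e t)
    ... | yes surplus = surplus-step l mm t e (λ mm′ → arc-delivers l mm′ (suc t)) budget surplus
    ... | no  deficit = deficit-step l mm t e (λ mm′ → arc-delivers l mm′ (suc t)) budget (≰⇒> deficit)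

  Q*[2^k∸1]+Q≡Q*2^k : ∀ k → Q * (2 ^ k ∸ 1) + Q ≡ Q * 2 ^ k
  Q*[2^k∸1]+Q≡Q*2^k k = begin
    Q * (2 ^ k ∸ 1) + Q      ≡⟨ cong (Q * (2 ^ k ∸ 1) +_) (sym (*-identityʳ Q)) ⟩
    Q * (2 ^ k ∸ 1) + Q * 1  ≡⟨ sym (*-distribˡ-+ Q (2 ^ k ∸ 1) 1) ⟩
    Q * (2 ^ k ∸ 1 + 1)      ≡⟨ cong (Q *_) (m∸n+n≡m (m^n>0 2 k)) ⟩
    Q * 2 ^ k                ∎
    where open ≡-Reasoning

  arc-cover : ∀ x l t → Q * (2 ^ suc l ∸ 1) ≤ weight x t (suc l) → Reach (arc x t (suc l)) (covered t (suc l))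
  arc-cover x l t saturated with arc-delivers x l 0 t (λ _ → 0) budget
    where
    budget : Budget l 0 x t (λ _ → 0)
    budget = subst₂ _≤_ (trans (+-comm Q _) (trans (Q*[2^k∸1]+Q≡Q*2^k (suc l)) (sym (+-identityʳ _))))
                        (cong (λ z → Q + (z + weight x t (suc l))) (sym (Σᶠ-zero g)))
                        (+-monoʳ-≤ Q saturated)
  ... | y , Q≤Σy , deliver =
    arc x t (suc l)
      ≥⟨ (λ v → ≤-reflexive (cong (_+ arc x t (suc l) v) (layer-zero (pos t) v))) ⟩
    layer (pos t) (λ _ → 0) ⊕ arc x t (suc l)
      →⟨ deliver ⟩
    layer (pos t) y ⊕ covered (suc t) l
      →⟨ reach-⊕ (cover-layer (pos t) y (subst (_≤ _) (+-identityʳ Q) Q≤Σy)) (covered (suc t) l ∎) ⟩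
    covered t (suc l) ∎
    where open Reach-Reasoning

  fibre : (Fin g × Fin n → ℕ) → ℕ → Fin g → ℕ
  fibre D j w = D (w , pos j)

  arc-fibre-all : ∀ D t v → arc (fibre D) t n v ≡ D v
  arc-fibre-all D t (w , u) = trans (window-period-Σᶠ n (λ z → indicator z u (D (w , z))) t)
                                    (Σᶠ-indicator n (λ z → D (w , z)) u)

  covered-all : ∀ t v → covered t n v ≡ 1
  covered-all t (w , u) = trans (window-period-Σᶠ n (λ z → indicator z u 1) t) (Σᶠ-indicator n (λ _ → 1) u)

  complementary-arcs-cover : ∀ D a b t → suc a + suc b ≡ n →
    Saturated (tildeD g n D ∘ pos) Q (suc a) t → Saturated (tildeD g n D ∘ pos) Q (suc b) (t + suc a) →
    Coverable (ProdAdj G n) D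
  complementary-arcs-cover D a b t a+b≡n sat-a sat-b = reach-weaken
    (λ v → ≤-reflexive (trans (split-arc (λ j → layer (pos j) (fibre D j) v)) (arc-fibre-all D t v)))
    (λ v → ≤-reflexive (sym (trans (split-arc (λ j → layer (pos j) (λ _ → 1) v)) (covered-all t v))))
    (reach-⊕ (arc-cover (fibre D) a t sat-a) (arc-cover (fibre D) b (t + suc a) sat-b))
    where
    split-arc : ∀ f → window f t (suc a) + window f (t + suc a) (suc b) ≡ window f t n
    split-arc f = trans (sym (window-+ f t (suc a) (suc b))) (cong (window f t) a+b≡n)

-- Saturated windows

2^k≡1+[2^k∸1] : ∀ k → 2 ^ k ≡ suc (2 ^ k ∸ 1)
2^k≡1+[2^k∸1] k = sym (trans (+-comm 1 _) (m∸n+n≡m (m^n>0 2 k)))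

[2^r+2^[r+1]]∸3≡3*[2^r∸1] : ∀ r → 2 ^ r + 2 ^ (r + 1) ∸ 3 ≡ 3 * (2 ^ r ∸ 1)
[2^r+2^[r+1]]∸3≡3*[2^r∸1] r = begin
  2 ^ r + 2 ^ (r + 1) ∸ 3                     ≡⟨ cong (λ e → 2 ^ r + 2 ^ e ∸ 3) (+-comm r 1) ⟩
  2 ^ r + 2 * 2 ^ r ∸ 3                       ≡⟨ cong (λ z → z + 2 * z ∸ 3) (2^k≡1+[2^k∸1] r) ⟩
  suc p + 2 * suc p ∸ 3                       ≡⟨ cong (_∸ 3) (regroup p) ⟩
  3 + 3 * p ∸ 3                               ≡⟨ m+n∸m≡n 3 (3 * p) ⟩
  3 * p                                       ∎
  where
  open ≡-Reasoning
  p = 2 ^ r ∸ 1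
  regroup : ∀ p → suc p + 2 * suc p ≡ 3 + 3 * p
  regroup = solve-∀

[2^[1+s]+2^[s+1]]∸3≡1+4*[2^s∸1] : ∀ s → 2 ^ suc s + 2 ^ (s + 1) ∸ 3 ≡ 1 + 4 * (2 ^ s ∸ 1)
[2^[1+s]+2^[s+1]]∸3≡1+4*[2^s∸1] s = begin
  2 ^ suc s + 2 ^ (s + 1) ∸ 3             ≡⟨ cong (λ e → 2 ^ suc s + 2 ^ e ∸ 3) (+-comm s 1) ⟩
  2 * 2 ^ s + 2 * 2 ^ s ∸ 3               ≡⟨ cong (λ z → 2 * z + 2 * z ∸ 3) (2^k≡1+[2^k∸1] s) ⟩
  2 * suc p + 2 * suc p ∸ 3               ≡⟨ cong (_∸ 3) (regroup p) ⟩
  3 + (1 + 4 * p) ∸ 3                     ≡⟨ m+n∸m≡n 3 (1 + 4 * p) ⟩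
  1 + 4 * p                               ∎
  where
  open ≡-Reasoning
  p = 2 ^ s ∸ 1
  regroup : ∀ p → 2 * suc p + 2 * suc p ≡ 3 + (1 + 4 * p)
  regroup = solve-∀

2^[1+s]∸1≡1+2*[2^s∸1] : ∀ s → 2 ^ suc s ∸ 1 ≡ 1 + 2 * (2 ^ s ∸ 1)
2^[1+s]∸1≡1+2*[2^s∸1] s = begin
  2 * 2 ^ s ∸ 1              ≡⟨ cong (λ z → 2 * z ∸ 1) (2^k≡1+[2^k∸1] s) ⟩
  2 * suc p ∸ 1              ≡⟨ cong (_∸ 1) (regroup p) ⟩
  1 + (1 + 2 * p) ∸ 1        ≡⟨ m+n∸m≡n 1 (1 + 2 * p) ⟩
  1 + 2 * p                  ∎
  where
  open ≡-Reasoning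
  p = 2 ^ s ∸ 1
  regroup : ∀ p → 2 * suc p ≡ 1 + (1 + 2 * p)
  regroup = solve-∀

k<2^k : ∀ k → k < 2 ^ k
k<2^k zero    = s≤s z≤n
k<2^k (suc k) = begin
  suc (suc k)      ≤⟨ s≤s (m≤m+n (suc k) k) ⟩
  suc (suc k + k)  ≡⟨ cong suc (sym (+-suc k k)) ⟩
  suc k + suc k    ≤⟨ +-mono-≤ (k<2^k k) (k<2^k k) ⟩
  2 ^ k + 2 ^ k    ≡⟨ cong (2 ^ k +_) (sym (+-identityʳ (2 ^ k))) ⟩
  2 ^ suc k        ∎
  where open ≤-Reasoning

window-≤-head+next : ∀ f a r → window f a r ≤ f a + window f (suc a) r
window-≤-head+next f a zero    = z≤n
window-≤-head+next f a (suc r) =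
  +-monoʳ-≤ (f a) (≤-trans (m≤m+n _ _) (≤-reflexive (sym (window-snoc f (suc a) r))))

saturated-unsaturated⇒primary : ∀ f Q r a → Saturated f Q r a → ¬ Saturated f Q r (suc a) → Primary f a
saturated-unsaturated⇒primary f Q r a sat unsat = ≰⇒> λ fa≤0 →
  unsat (≤-trans sat (≤-trans (window-≤-head+next f a r) (≤-reflexive (cong (_+ window f (suc a) r) (n≤0⇒n≡0 fa≤0)))))

saturated-descent : ∀ f Q r d t → Saturated f Q r t → ¬ Saturated f Q r (t + d) →
                    ∃[ a ] (Saturated f Q r a × ¬ Saturated f Q r (suc a))
saturated-descent f Q r zero    t sat unsat = ⊥-elim (unsat (subst (Saturated f Q r) (sym (+-identityʳ t)) sat))
saturated-descent f Q r (suc d) t sat unsat with Q * (2 ^ r ∸ 1) ≤? window f (suc t) r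
... | yes sat′   = saturated-descent f Q r d (suc t) sat′ (unsat ∘ subst (Saturated f Q r) (sym (+-suc t d)))
... | no  unsat′ = t , sat , unsat′

module Counting (n : ℕ) .⦃ _ : NonZero n ⦄ (c : ℕ → ℕ) (periodic : ∀ j → c (j + n) ≡ c j) (Q : ℕ) where

  open Periodic n c periodic

  Sat : ℕ → ℕ → Set
  Sat r = Saturated c Q r

  saturated-then-unsaturated : ∀ r {t₀ t₁} → Sat r t₀ → ¬ Sat r t₁ → ∃[ a ] (Sat r a × ¬ Sat r (suc a))
  saturated-then-unsaturated r {t₀} {t₁} sat unsat =
    saturated-descent c Q r (t₁ + t₀ * n ∸ t₀) t₀ sat
      (unsat ∘ subst (Q * (2 ^ r ∸ 1) ≤_) (trans (cong (λ t → window c t r) t₀+d≡t₁+t₀*n) (window-+k*n t₀ t₁ r)))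
    where
    t₀+d≡t₁+t₀*n : t₀ + (t₁ + t₀ * n ∸ t₀) ≡ t₁ + t₀ * n
    t₀+d≡t₁+t₀*n = m+[n∸m]≡n (≤-trans (m≤m*n t₀ n) (m≤n+m (t₀ * n) t₁))

  saturated-somewhere : ∀ r → ¬ (∀ t → ¬ Sat r t) → ∃ (Sat r)
  saturated-somewhere r ¬none with any? (λ (i : Fin n) → Q * (2 ^ r ∸ 1) ≤? window c (toℕ i) r)
  ... | yes (i , sat) = toℕ i , sat
  ... | no  ¬∃sat     = ⊥-elim (¬none λ t sat → ¬∃sat (t mod n ,
        subst (λ j → Q * (2 ^ r ∸ 1) ≤ window c j r) (sym (toℕ-mod n t)) (subst (Q * (2 ^ r ∸ 1) ≤_) (window-mod t r) sat)))

  private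
    T = window c 0 n

    T+2≰T : T + 2 ≤ T → ⊥
    T+2≰T = m+1+n≰m T

    window-full : ∀ t → window c t n ≡ T
    window-full = window-period

  module _ (r : ℕ) (r+r≡n : r + r ≡ n) where

    saturated-exists-even : T ≡ (2 ^ r + 2 ^ (r + 1) ∸ 3) * Q → ∃ (Sat r)
    saturated-exists-even T≡ with Q * (2 ^ r ∸ 1) ≤? window c 0 r | Q * (2 ^ r ∸ 1) ≤? window c r r
    ... | yes sat | _       = 0 , sat
    ... | no  _   | yes sat = r , sat
    ... | no  u₀  | no  u₁  = ⊥-elim (T+2≰T (begin
      T + 2                                        ≡⟨ cong (_+ 2) (trans (cong (window c 0) (sym r+r≡n)) (window-+ c 0 r r)) ⟩
      window c 0 r + window c r r + 2              ≡⟨ x+y+2≡[1+x]+[1+y] (window c 0 r) _ ⟩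
      suc (window c 0 r) + suc (window c r r)      ≤⟨ +-mono-≤ (≰⇒> u₀) (≰⇒> u₁) ⟩
      Q * (2 ^ r ∸ 1) + Q * (2 ^ r ∸ 1)            ≤⟨ m≤m+n _ _ ⟩
      Q * (2 ^ r ∸ 1) + Q * (2 ^ r ∸ 1) + Q * (2 ^ r ∸ 1) ≡⟨ 3M≡ (2 ^ r ∸ 1) Q ⟩
      3 * (2 ^ r ∸ 1) * Q                          ≡⟨ cong (_* Q) (sym ([2^r+2^[r+1]]∸3≡3*[2^r∸1] r)) ⟩
      (2 ^ r + 2 ^ (r + 1) ∸ 3) * Q                ≡⟨ sym T≡ ⟩
      T                                            ∎))
      where
      open ≤-Reasoning
      x+y+2≡[1+x]+[1+y] : ∀ x y → x + y + 2 ≡ suc x + suc y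
      x+y+2≡[1+x]+[1+y] = solve-∀
      3M≡ : ∀ p Q → Q * p + Q * p + Q * p ≡ 3 * p * Q
      3M≡ = solve-∀

  module _ (s : ℕ) (s+[1+s]≡n : s + suc s ≡ n) (T≡ : T ≡ (2 ^ suc s + 2 ^ (s + 1) ∸ 3) * Q) where

    private
      p = 2 ^ s ∸ 1

      T≡[1+4p]Q : T ≡ (1 + 4 * p) * Q
      T≡[1+4p]Q = trans T≡ (cong (_* Q) ([2^[1+s]+2^[s+1]]∸3≡1+4*[2^s∸1] s))

      overlapping-windows : ∀ a → window c a (suc s) + window c (a + s) (suc s) ≡ T + c (a + s)
      overlapping-windows a = begin
        window c a (suc s) + window c (a + s) (suc s)           ≡⟨ cong (_+ window c (a + s) (suc s)) (window-snoc c a s) ⟩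
        window c a s + c (a + s) + window c (a + s) (suc s)     ≡⟨ xy∙z≈xz∙y (window c a s) (c (a + s)) _ ⟩
        window c a s + window c (a + s) (suc s) + c (a + s)     ≡⟨ cong (_+ c (a + s)) (sym (window-+ c a s (suc s))) ⟩
        window c a (s + suc s) + c (a + s)                      ≡⟨ cong (λ l → window c a l + c (a + s)) s+[1+s]≡n ⟩
        window c a n + c (a + s)                                ≡⟨ cong (_+ c (a + s)) (window-full a) ⟩
        T + c (a + s)                                           ∎
        where open ≡-Reasoning

      low-if-unsaturated : (∀ t → ¬ Sat (suc s) t) → ∀ a → c (a + s) + 2 ≤ Q
      low-if-unsaturated none a = +-cancelˡ-≤ T _ _ (begin
        T + (c (a + s) + 2)                                     ≡⟨ sym (+-assoc T _ 2) ⟩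
        T + c (a + s) + 2                                       ≡⟨ cong (_+ 2) (sym (overlapping-windows a)) ⟩
        window c a (suc s) + window c (a + s) (suc s) + 2       ≡⟨ x+y+2≡[1+x]+[1+y] (window c a (suc s)) _ ⟩
        suc (window c a (suc s)) + suc (window c (a + s) (suc s)) ≤⟨ +-mono-≤ (≰⇒> (none a)) (≰⇒> (none (a + s))) ⟩
        M + M                                                   ≡⟨ cong (λ z → Q * z + Q * z) (2^[1+s]∸1≡1+2*[2^s∸1] s) ⟩
        Q * (1 + 2 * p) + Q * (1 + 2 * p)                       ≡⟨ regroup Q p ⟩
        (1 + 4 * p) * Q + Q                                     ≡⟨ cong (_+ Q) (sym T≡[1+4p]Q) ⟩
        T + Q                                                   ∎)
        where
        open ≤-Reasoning
        M = Q * (2 ^ suc s ∸ 1)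
        x+y+2≡[1+x]+[1+y] : ∀ x y → x + y + 2 ≡ suc x + suc y
        x+y+2≡[1+x]+[1+y] = solve-∀
        regroup : ∀ Q p → Q * (1 + 2 * p) + Q * (1 + 2 * p) ≡ (1 + 4 * p) * Q + Q
        regroup = solve-∀

      n≤1+4p : n ≤ 1 + 4 * p
      n≤1+4p = begin
        n                          ≡⟨ sym s+[1+s]≡n ⟩
        s + suc s                  ≡⟨ +-suc s s ⟩
        1 + (s + s)                ≤⟨ +-monoʳ-≤ 1 (+-mono-≤ s≤p (≤-trans s≤p (m≤m+n p _))) ⟩
        1 + (p + (p + (p + p)))    ≡⟨ cong (1 +_) (4*p≡ p) ⟩
        1 + 4 * p                  ∎
        where
        open ≤-Reasoning
        s≤p : s ≤ p
        s≤p = m+n≤o⇒m≤o∸n s (subst (_≤ 2 ^ s) (+-comm 1 s) (k<2^k s))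
        4*p≡ : ∀ p → p + (p + (p + p)) ≡ 4 * p
        4*p≡ = solve-∀

    -- Otherwise every vertex carries at most Q − 2 pebbles, too few for the n vertices.
    saturated-exists-odd : ∃ (Sat (suc s))
    saturated-exists-odd = saturated-somewhere (suc s) λ none →
      let low = low-if-unsaturated none
          Q≥2 = ≤-trans (m≤n+m 2 _) (low 0)
      in T+2≰T (begin
        T + 2                                 ≡⟨ cong (_+ 2) (sym (window-full s)) ⟩
        window c s n + 2                      ≡⟨ cong (_+ 2) (window-shift c (λ j → c (j + s)) s 0 n (λ j → cong c (+-comm s j))) ⟩
        window (λ j → c (j + s)) 0 n + 2      ≤⟨ +-mono-≤ (window-≤-* _ (Q ∸ 2) 0 n (λ a → m+n≤o⇒m≤o∸n _ (low a))) (m≤n*m 2 n) ⟩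
        n * (Q ∸ 2) + n * 2                   ≡⟨ sym (*-distribˡ-+ n (Q ∸ 2) 2) ⟩
        n * (Q ∸ 2 + 2)                       ≡⟨ cong (n *_) (m∸n+n≡m Q≥2) ⟩
        n * Q                                 ≤⟨ *-monoˡ-≤ Q n≤1+4p ⟩
        (1 + 4 * p) * Q                       ≡⟨ sym T≡[1+4p]Q ⟩
        T                                     ∎)
      where open ≤-Reasoning

    saturated-short-arc : 1 ≤ s → ∃ (Sat s)
    saturated-short-arc s≥1 with Q * p ≤? window c 0 s | Q * p ≤? window c s s | Q * p ≤? window c (s + s) s
    ... | yes sat | _       | _       = 0 , sat
    ... | no _    | yes sat | _       = s , sat
    ... | no _    | no _    | yes sat = s + s , sat
    ... | no u₀   | no u₁   | no u₂   = ⊥-elim (m+1+n≰m T (begin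
      T + 3                                                 ≡⟨ cong (_+ 3) T≡three-parts ⟩
      window c 0 s + (window c s s + c (s + s)) + 3         ≡⟨ regroup (window c 0 s) (window c s s) (c (s + s)) ⟩
      suc (window c 0 s) + suc (window c s s) + suc (c (s + s))
        ≤⟨ +-mono-≤ (+-mono-≤ (≰⇒> u₀) (≰⇒> u₁)) (≤-trans (s≤s (head≤window c (s + s) s≥1)) (≰⇒> u₂)) ⟩
      Q * p + Q * p + Q * p                                 ≤⟨ m≤m+n _ (Q + Q * p) ⟩
      Q * p + Q * p + Q * p + (Q + Q * p)                   ≡⟨ regroup′ Q p ⟩
      (1 + 4 * p) * Q                                       ≡⟨ sym T≡[1+4p]Q ⟩
      T                                                     ∎))
      where
      open ≤-Reasoning
      T≡three-parts : T ≡ window c 0 s + (window c s s + c (s + s))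
      T≡three-parts = trans (cong (window c 0) (sym s+[1+s]≡n))
                            (trans (window-+ c 0 s (suc s)) (cong (window c 0 s +_) (window-snoc c s s)))
      regroup : ∀ x y z → x + (y + z) + 3 ≡ suc x + suc y + suc z
      regroup = solve-∀
      regroup′ : ∀ Q p → Q * p + Q * p + Q * p + (Q + Q * p) ≡ (1 + 4 * p) * Q
      regroup′ = solve-∀

module HalfCycle (G : Graph) (m Q : ℕ) (allCoverable : AllCoverable G Q)
                 (D : Fin (Graph.size G) × Fin (2 + m) → ℕ) where

  open Product G m Q allCoverable

  c : ℕ → ℕ
  c = tildeD g n D ∘ pos

  c-periodic : ∀ j → c (j + n) ≡ c j
  c-periodic j = cong (tildeD g n D) ([m+n]mod-n≡m-mod-n n j)

  open Counting n c c-periodic Q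

  window-c≡totalProd : window c 0 n ≡ totalProd g n D
  window-c≡totalProd = trans (window-period-Σᶠ n (tildeD g n D) 0) (sym (Σᶠ-comm g n (λ i j → D (i , j))))

  half-windows : ∀ f r → f + r ≡ n → r ≡ f ⊎ r ≡ suc f → ¬ Coverable (ProdAdj G n) D →
                 window c 0 n ≡ (2 ^ r + 2 ^ (f + 1) ∸ 3) * Q → ∃ (Sat r) × ∃ (¬_ ∘ Sat r)
  half-windows (suc h) .(suc h) f+r≡n (inj₁ refl) nonCoverable T≡ =
    saturated-exists-even (suc h) f+r≡n T≡ , unsaturated
    where
    unsaturated : ∃ (¬_ ∘ Sat (suc h))
    unsaturated with Q * (2 ^ suc h ∸ 1) ≤? window c 0 (suc h)
    ... | yes sat₀ = suc h , λ sat → nonCoverable (complementary-arcs-cover D h h 0 f+r≡n sat₀ sat)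
    ... | no  unsat = 0 , unsat
  half-windows (suc h) .(suc (suc h)) f+r≡n (inj₂ refl) nonCoverable T≡
    with saturated-short-arc (suc h) f+r≡n T≡ (s≤s z≤n)
  ... | t , sat = saturated-exists-odd (suc h) f+r≡n T≡ ,
                  (t + suc h , λ sat′ → nonCoverable (complementary-arcs-cover D h (suc h) t f+r≡n sat sat′))

  sequential-labeling : ∀ r a → 1 ≤ r → Sat r a → ¬ Sat r (suc a) →
    ∃[ k ] ∃[ b ]
      (let f : ℕ → ℕ
           f s = tildeD g n D (seqLab {n} k b s)
       in (Primary f 1 × Saturated f Q r 1)
          × ∃[ i ] (1 ≤ i × i ≤ r + 1 × ¬ Saturated f Q r i
                    × (∀ s → 1 < s → s < i → ¬ Support (f s))))
  sequential-labeling r a r≥1 sat unsat =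
    pos a , true
    , (subst (1 ≤_) (sym (trans f-from-a (cong c (+-identityʳ a)))) (saturated-unsaturated⇒primary c Q r a sat unsat)
      , subst (Q * (2 ^ r ∸ 1) ≤_) (sym (window-shift f c 1 a r (λ j → f-from-a))) sat)
    , 2 , s≤s z≤n , subst (2 ≤_) (+-comm 1 r) (s≤s r≥1)
    , unsat ∘ subst (Q * (2 ^ r ∸ 1) ≤_) (window-shift f c 2 (suc a) r (λ j → trans f-from-a (cong c (+-suc a j))))
    , λ { s (s≤s (s≤s _)) (s≤s (s≤s ())) }
    where
    f : ℕ → ℕ
    f s = tildeD g n D (seqLab {n} (pos a) true s)
    f-from-a : ∀ {j} → f (suc j) ≡ c (a + j)
    f-from-a {j} = cong (tildeD g n D) ([toℕ[a-mod-n]+j]mod-n n a j)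

lemma3p3 : (G : Graph) (Q : ℕ) → IsCoverPebblingNumber G Q →
    (n : ℕ) → 3 ≤ n →
    (D : Fin (Graph.size G) × Fin n → ℕ) →
    totalProd (Graph.size G) n D ≡ (2 ^ ⌈ n /2⌉ + 2 ^ (n ∸ ⌈ n /2⌉ + 1) ∸ 3) * Q →
    ¬ Coverable (ProdAdj G n) D →
    ∃[ k ] ∃[ b ]
      (let f : ℕ → ℕ
           f s = tildeD (Graph.size G) n D (seqLab {n} k b s)
       in (Primary f 1 × Saturated f Q ⌈ n /2⌉ 1)
          × ∃[ i ] (1 ≤ i × i ≤ ⌈ n /2⌉ + 1 × ¬ Saturated f Q ⌈ n /2⌉ i
                    × (∀ s → 1 < s → s < i → ¬ Support (f s))))
lemma3p3 G Q (allCoverable , _) (suc (suc (suc k))) (s≤s (s≤s (s≤s _))) D total nonCoverable =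
  let (_ , sat) , (_ , unsat) = half-windows ⌊ n /2⌋ r (⌊n/2⌋+⌈n/2⌉≡n n) (⌈n/2⌉≡⌊n/2⌋⊎⌈n/2⌉≡1+⌊n/2⌋ n)
                                  nonCoverable window-c≡P*Q
      a , sat-a , unsat-a+1     = saturated-then-unsaturated r sat unsat
  in sequential-labeling r a (s≤s z≤n) sat-a unsat-a+1
  where
  n = 3 + k
  r = ⌈ n /2⌉
  open HalfCycle G (suc k) Q allCoverable D
  open Counting n c c-periodic Q
  window-c≡P*Q : window c 0 n ≡ (2 ^ r + 2 ^ (⌊ n /2⌋ + 1) ∸ 3) * Q
  window-c≡P*Q = trans window-c≡totalProd (trans total (cong (λ f → (2 ^ r + 2 ^ (f + 1) ∸ 3) * Q)
                   (trans (cong (_∸ r) (sym (⌊n/2⌋+⌈n/2⌉≡n n))) (m+n∸n≡m ⌊ n /2⌋ r))))
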